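{- Let $n\ge 1$ and let $\beta\in B_n$ be a signed permutation. Then $$d_R(\beta)=\mathrm{des}_B(\beta)\qquad\text{and}\qquad \mathrm{maj}_R(\beta)=\mathrm{maj}(\beta)+\mathrm{neg}(\beta).$$
   Context: $B_n$ is the group of bijections $\beta$ of $[-n,n]\setminus\{0\}$ with $\beta(-i)=-\beta(i)$, written in window notation $\beta=[\beta(1),\dots,\beta(n)]$. $\mathrm{neg}(\beta)=|\{i\in[n]:\beta(i)<0\}|$. The $B$-descent set is $\mathrm{Des}_B(\beta)=\{i\in[0,n-1]:\beta(i)>\beta(i+1)\}$, computed with the natural order $-n<\dots<-1<0<1<\dots<n$ and the convention $\beta(0):=0$; $\mathrm{des}_B(\beta)=|\mathrm{Des}_B(\beta)|$ and $\mathrm{maj}(\beta)=\sum_{i\in\mathrm{Des}_B(\beta)}i$. Reiner's descent set uses the total order $<_R$ on $[-n,n]\setminus\{0\}$ given by $1<_R2<_R\dots<_Rn<_R-n<_R\dots<_R-1$: $\mathrm{Des}_R(\beta)=\{i\in[1,n]:\beta(i)>_R\beta(i+1)\}$ with the convention $\beta(n+1):=n$; $d_R(\beta)=|\mathrm{Des}_R(\beta)|$ and $\mathrm{maj}_R(\beta)=\sum_{i\in\mathrm{Des}_R(\beta)}i$. -}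

module Defs where

open import Data.Nat using (ℕ; zero; suc; _+_; _*_; _∸_)
import Data.Nat as ℕ
open import Data.Integer as ℤ using (ℤ; +_; -[1+_]; -_; 0ℤ)
open import Data.Fin using (Fin; toℕ)
open import Data.Fin.Permutation using (Permutation′; _⟨$⟩ʳ_)
open import Data.Bool using (Bool; true; false; if_then_else_)
open import Data.List using (List; []; _∷_; map; filter; length; allFin; _++_; [_])
open import Data.Nat.ListAction using (sum)
open import Data.Product using (_×_; _,_; proj₁; proj₂)

-- A signed permutation β ∈ B_n, determined by its window [β(1),…,β(n)]:
-- β(i) = ± (σ(i) + 1) where σ is a permutation of Fin n and the sign
-- is negative exactly when  negative i = true.  (Every element of B_n
-- arises uniquely this way; β(-i) = -β(i) then determines the rest.)
record SignedPerm (n : ℕ) : Set where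
  constructor signedPerm
  field
    perm     : Permutation′ n
    negative : Fin n → Bool

open SignedPerm public

-- β(i+1) for i : Fin n  (positions are 1-based in the paper)
value : ∀ {n} → SignedPerm n → Fin n → ℤ
value β i = if negative β i
              then - (+ suc (toℕ (perm β ⟨$⟩ʳ i)))
              else + suc (toℕ (perm β ⟨$⟩ʳ i))

window : ∀ {n} → SignedPerm n → List ℤ
window {n} β = map (value β) (allFin n)

pairsFrom : {A : Set} → ℕ → List A → List (ℕ × A × A)
pairsFrom k [] = []
pairsFrom k (x ∷ []) = []
pairsFrom k (x ∷ y ∷ xs) = (k , x , y) ∷ pairsFrom (suc k) (y ∷ xs)

neg : ∀ {n} → SignedPerm n → ℕ
neg β = length (filter (λ x → x ℤ.<? 0ℤ) (window β))

DesB : ∀ {n} → SignedPerm n → List ℕ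
DesB β = map proj₁ (filter (λ t → proj₂ (proj₂ t) ℤ.<? proj₁ (proj₂ t))
                           (pairsFrom 0 (0ℤ ∷ window β)))

desB : ∀ {n} → SignedPerm n → ℕ
desB β = length (DesB β)

maj : ∀ {n} → SignedPerm n → ℕ
maj β = sum (DesB β)

-- Reiner's total order 1 <_R 2 <_R … <_R n <_R -n <_R … <_R -1 on
-- [-n,n]∖{0}, realised by a rank into ℕ:  k ↦ k for k > 0,
-- -k ↦ 2n + 1 - k for k > 0  (so -n ↦ n+1, …, -1 ↦ 2n).
rankR : ℕ → ℤ → ℕ
rankR n (+ k) = k
rankR n -[1+ k ] = (2 * n) ∸ k

DesR : ∀ {n} → SignedPerm n → List ℕ
DesR {n} β = map proj₁ (filter (λ t → rankR n (proj₂ (proj₂ t)) ℕ.<? rankR n (proj₁ (proj₂ t)))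
                               (pairsFrom 1 (window β ++ [ + n ])))

dR : ∀ {n} → SignedPerm n → ℕ
dR β = length (DesR β)

majR : ∀ {n} → SignedPerm n → ℕ
majR β = sum (DesR β)

module Submission where

-- Write s(x) ∈ {0,1} for "x < 0", b(x,y) for the ordinary
-- descent "x > y" and r(x,y) for Reiner's descent "x >_R y".  For any two
-- entries x, y ∈ [-n,n] one checks, by the four sign cases, the local
-- exchange law
--          r(x,y) + s(y) = b(x,y) + s(x),
-- and for the appended entry β(n+1) = n one has r(x,n) = s(x).  Summing the
-- exchange law along the window β(1),…,β(n),n telescopes:
--   * unweighted, the number of Reiner descents equals the number of
--     ordinary descents of β(1),…,β(n) plus s(β(1)), and s(β(1)) is exactly
--     the descent of 0, β(1) at position 0, so d_R = des_B;
--   * weighted by positions, the extra term (i+1)·s(β(i+1)) − i·s(β(i+1))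
--     contributes s(β(i+1)) once per entry, which yields maj_R = maj + neg.

open import Defs
open import Data.Nat using (ℕ; _≥_; _+_)
open import Data.Product using (_×_)
open import Relation.Binary.PropositionalEquality using (_≡_)

open import Data.Nat as ℕ using (suc; _*_; _∸_; _≤_; _<_)
open import Data.Nat.Properties
open import Data.Nat.ListAction using (sum)
open import Data.Nat.Tactic.RingSolver using (solve-∀)
open import Data.Integer as ℤ using (ℤ; +_; -[1+_]; 0ℤ)
open import Data.Fin using (Fin)
import Data.Fin as Fin
open import Data.Fin.Properties using (toℕ<n)
open import Data.Fin.Permutation using (_⟨$⟩ʳ_)
open import Data.Bool using (Bool; true; false)
open import Data.List using (List; []; _∷_; map; filter; length; tabulate; _++_; [_])
open import Data.List.Relation.Unary.All using (All; []; _∷_; universal)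
open import Data.List.Relation.Unary.All.Properties using (map⁺)
open import Data.Product using (_,_; proj₁; proj₂)
open import Function.Bundles using (mk⇔)
open import Relation.Nullary using (does)
open import Relation.Nullary.Decidable using (dec-true; dec-false; does-⇔)
open import Relation.Unary using (Pred; Decidable)
open import Relation.Binary.PropositionalEquality using (refl; sym; trans; cong; cong₂; module ≡-Reasoning)
open import Level using (0ℓ)

indicator : Bool → ℕ
indicator true  = 1
indicator false = 0

InRange : ℕ → ℤ → Set
InRange n (+ p)    = p ≤ n
InRange n -[1+ p ] = p < n

-- Negative entries -(q+1) ∈ [-n,-1] have Reiner rank 2n - q > n, so they
-- are above every positive entry in the order <_R.
negative-rank-above : ∀ n q → q < n → n < 2 * n ∸ q
negative-rank-above n q q<n = begin-strict
  n            ≡⟨ +-identityʳ n ⟨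
  n + 0        <⟨ +-monoʳ-< n (m<n⇒0<n∸m q<n) ⟩
  n + (n ∸ q)  ≡⟨ +-∸-assoc n (<⇒≤ q<n) ⟨
  n + n ∸ q    ≡⟨ cong (λ m → n + m ∸ q) (+-identityʳ n) ⟨
  2 * n ∸ q    ∎
  where open ≤-Reasoning

module Statistics (n : ℕ) where
  r : ℤ → ℤ → ℕ
  r x y = indicator (does (rankR n y ℕ.<? rankR n x))

  b : ℤ → ℤ → ℕ
  b x y = indicator (does (y ℤ.<? x))

  s : ℤ → ℕ
  s x = indicator (does (x ℤ.<? 0ℤ))

  s-nonneg : ∀ p → s (+ p) ≡ 0
  s-nonneg p = cong indicator (dec-false (+ p ℤ.<? 0ℤ) λ { (ℤ.+<+ ()) })

  -- Both entries positive or both negative: r and b agree (on negatives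
  -- the rank 2n - q reverses the order exactly as the integers do); mixed
  -- signs: the negative entry is <_R-largest but <-smallest.
  exchange : ∀ x y → InRange n x → InRange n y → r x y + s y ≡ b x y + s x
  exchange (+ p) (+ q) _ _
    rewrite s-nonneg p | s-nonneg q = refl
  exchange (+ p) -[1+ q ] p≤n q<n
    rewrite s-nonneg p
          | dec-false (2 * n ∸ q ℕ.<? p)
              (λ lt → <⇒≱ (≤-<-trans p≤n (negative-rank-above n q q<n)) (<⇒≤ lt))
          = refl
  exchange -[1+ p ] (+ q) p<n q≤n
    rewrite s-nonneg q
          | dec-true (q ℕ.<? 2 * n ∸ p) (≤-<-trans q≤n (negative-rank-above n p p<n))
          = refl
  exchange -[1+ p ] -[1+ q ] p<n q<n =
    cong (λ d → indicator d + 1)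
      (does-⇔ (mk⇔ rank-order-reversed (λ p<q → ∸-monoʳ-< p<q q≤2n))
              (2 * n ∸ q ℕ.<? 2 * n ∸ p) (p ℕ.<? q))
    where
    q≤2n : q ≤ 2 * n
    q≤2n = ≤-trans (<⇒≤ q<n) (m≤m+n n (n + 0))

    rank-order-reversed : 2 * n ∸ q < 2 * n ∸ p → p < q
    rank-order-reversed lt = ≰⇒> (λ q≤p → <⇒≱ lt (∸-monoʳ-≤ (2 * n) q≤p))

  exchange-last : ∀ x → InRange n x → r x (+ n) ≡ s x
  exchange-last (+ p) p≤n
    rewrite s-nonneg p | dec-false (n ℕ.<? p) (λ lt → <⇒≱ lt p≤n) = refl
  exchange-last -[1+ p ] p<n
    rewrite dec-true (n ℕ.<? 2 * n ∸ p) (negative-rank-above n p p<n) = refl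

positions : {A : Set} {P : Pred (ℕ × A × A) 0ℓ} → Decidable P → ℕ → List A → List ℕ
positions P? k xs = map proj₁ (filter P? (pairsFrom k xs))

module _ {A : Set} {P : Pred A 0ℓ} (P? : Decidable P) where
  length-filter-∷ : ∀ a l → length (filter P? (a ∷ l)) ≡ indicator (does (P? a)) + length (filter P? l)
  length-filter-∷ a l with does (P? a)
  ... | true  = refl
  ... | false = refl

module _ {A : Set} {P : Pred (ℕ × A × A) 0ℓ} (P? : Decidable P) where
  count-positions-∷ : ∀ k x y w →
    length (positions P? k (x ∷ y ∷ w))
      ≡ indicator (does (P? (k , x , y))) + length (positions P? (suc k) (y ∷ w))
  count-positions-∷ k x y w with does (P? (k , x , y))
  ... | true  = refl
  ... | false = refl

  sum-positions-∷ : ∀ k x y w →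
    sum (positions P? k (x ∷ y ∷ w))
      ≡ k * indicator (does (P? (k , x , y))) + sum (positions P? (suc k) (y ∷ w))
  sum-positions-∷ k x y w with does (P? (k , x , y))
  ... | true  = sym (cong (_+ sum (positions P? (suc k) (y ∷ w))) (*-identityʳ k))
  ... | false = sym (cong (_+ sum (positions P? (suc k) (y ∷ w))) (*-zeroʳ k))

module Telescoping (n : ℕ) where
  open Statistics n

  reinerDescent? : Decidable {A = ℕ × ℤ × ℤ} λ t → rankR n (proj₂ (proj₂ t)) < rankR n (proj₁ (proj₂ t))
  reinerDescent? t = rankR n (proj₂ (proj₂ t)) ℕ.<? rankR n (proj₁ (proj₂ t))

  descent? : Decidable {A = ℕ × ℤ × ℤ} λ t → proj₂ (proj₂ t) ℤ.< proj₁ (proj₂ t)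
  descent? t = proj₂ (proj₂ t) ℤ.<? proj₁ (proj₂ t)

  negative? : Decidable {A = ℤ} λ x → x ℤ.< 0ℤ
  negative? x = x ℤ.<? 0ℤ

  negatives : List ℤ → ℕ
  negatives w = length (filter negative? w)

  count-telescopes : ∀ k x w → InRange n x → All (InRange n) w →
    length (positions reinerDescent? k (x ∷ w ++ [ + n ]))
      ≡ length (positions descent? k (x ∷ w)) + s x
  count-telescopes k x [] x∈ [] = begin
    length (positions reinerDescent? k (x ∷ + n ∷ []))
                   ≡⟨ count-positions-∷ reinerDescent? k x (+ n) [] ⟩
    r x (+ n) + 0  ≡⟨ cong (_+ 0) (exchange-last x x∈) ⟩
    s x + 0        ≡⟨ +-identityʳ (s x) ⟩
    s x            ∎
    where open ≡-Reasoning
  count-telescopes k x (y ∷ w) x∈ (y∈ ∷ w∈) = begin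
    length (positions reinerDescent? k (x ∷ y ∷ w ++ [ + n ]))
      ≡⟨ count-positions-∷ reinerDescent? k x y (w ++ [ + n ]) ⟩
    r x y + length (positions reinerDescent? (suc k) (y ∷ w ++ [ + n ]))
      ≡⟨ cong (λ e → r x y + e) (count-telescopes (suc k) y w y∈ w∈) ⟩
    r x y + (L + s y)  ≡⟨ x∙yz≈y∙xz (r x y) L (s y) ⟩
    L + (r x y + s y)  ≡⟨ cong (λ e → L + e) (exchange x y x∈ y∈) ⟩
    L + (b x y + s x)  ≡⟨ x∙yz≈yx∙z L (b x y) (s x) ⟩
    (b x y + L) + s x  ≡⟨ cong (_+ s x) (count-positions-∷ descent? k x y w) ⟨
    length (positions descent? k (x ∷ y ∷ w)) + s x ∎
    where
    open ≡-Reasoning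
    open import Algebra.Properties.CommutativeSemigroup +-commutativeSemigroup
      using (x∙yz≈y∙xz; x∙yz≈yx∙z)
    L : ℕ
    L = length (positions descent? (suc k) (y ∷ w))

  -- Weighted by positions: the extra term of an entry y at position k+1
  -- is (k+1)·s(y) on the Reiner side against k·s(y) on the ordinary side,
  -- so each entry after the first contributes s(y) once more.
  sum-telescopes : ∀ k x w → InRange n x → All (InRange n) w →
    sum (positions reinerDescent? k (x ∷ w ++ [ + n ]))
      ≡ sum (positions descent? k (x ∷ w)) + k * s x + negatives w
  sum-telescopes k x [] x∈ [] =
    trans (sum-positions-∷ reinerDescent? k x (+ n) []) (cong (λ e → k * e + 0) (exchange-last x x∈))
  sum-telescopes k x (y ∷ w) x∈ (y∈ ∷ w∈) = begin
    sum (positions reinerDescent? k (x ∷ y ∷ w ++ [ + n ]))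
      ≡⟨ sum-positions-∷ reinerDescent? k x y (w ++ [ + n ]) ⟩
    k * r x y + sum (positions reinerDescent? (suc k) (y ∷ w ++ [ + n ]))
      ≡⟨ cong (λ e → k * r x y + e) (sum-telescopes (suc k) y w y∈ w∈) ⟩
    k * r x y + (S + suc k * s y + N)   ≡⟨ regroup-reiner k (r x y) S (s y) N ⟩
    k * (r x y + s y) + (S + s y + N)   ≡⟨ cong (λ e → k * e + (S + s y + N)) (exchange x y x∈ y∈) ⟩
    k * (b x y + s x) + (S + s y + N)   ≡⟨ regroup-ordinary k (b x y) (s x) S (s y) N ⟩
    (k * b x y + S) + k * s x + (s y + N)
      ≡⟨ cong₂ (λ D M → D + k * s x + M) (sum-positions-∷ descent? k x y w)
                                         (length-filter-∷ negative? y w) ⟨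
    sum (positions descent? k (x ∷ y ∷ w)) + k * s x + negatives (y ∷ w) ∎
    where
    open ≡-Reasoning
    S N : ℕ
    S = sum (positions descent? (suc k) (y ∷ w))
    N = negatives w

    regroup-reiner : ∀ k r S t N → k * r + (S + suc k * t + N) ≡ k * (r + t) + (S + t + N)
    regroup-reiner = solve-∀

    regroup-ordinary : ∀ k b u S t N → k * (b + u) + (S + t + N) ≡ (k * b + S) + k * u + (t + N)
    regroup-ordinary = solve-∀

  -- The two identities for a window y,w: position 0 carries the pair 0,y,
  -- which is an ordinary descent exactly when y is negative.
  reiner-count : ∀ y w → All (InRange n) (y ∷ w) →
    length (positions reinerDescent? 1 ((y ∷ w) ++ [ + n ]))
      ≡ length (positions descent? 0 (0ℤ ∷ y ∷ w))
  reiner-count y w (y∈ ∷ w∈) = begin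
    length (positions reinerDescent? 1 (y ∷ w ++ [ + n ]))
      ≡⟨ count-telescopes 1 y w y∈ w∈ ⟩
    length (positions descent? 1 (y ∷ w)) + s y
      ≡⟨ +-comm _ (s y) ⟩
    s y + length (positions descent? 1 (y ∷ w))
      ≡⟨ count-positions-∷ descent? 0 0ℤ y w ⟨
    length (positions descent? 0 (0ℤ ∷ y ∷ w)) ∎
    where open ≡-Reasoning

  reiner-major : ∀ y w → All (InRange n) (y ∷ w) →
    sum (positions reinerDescent? 1 ((y ∷ w) ++ [ + n ]))
      ≡ sum (positions descent? 0 (0ℤ ∷ y ∷ w)) + negatives (y ∷ w)
  reiner-major y w (y∈ ∷ w∈) = begin
    sum (positions reinerDescent? 1 (y ∷ w ++ [ + n ]))
      ≡⟨ sum-telescopes 1 y w y∈ w∈ ⟩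
    S + 1 * s y + negatives w
      ≡⟨ +-assoc S (1 * s y) (negatives w) ⟩
    S + (1 * s y + negatives w)
      ≡⟨ cong₂ (λ D M → D + M) (sum-positions-∷ descent? 0 0ℤ y w)
                               (trans (length-filter-∷ negative? y w)
                                      (sym (cong (_+ negatives w) (*-identityˡ (s y))))) ⟨
    sum (positions descent? 0 (0ℤ ∷ y ∷ w)) + negatives (y ∷ w) ∎
    where
    open ≡-Reasoning
    S : ℕ
    S = sum (positions descent? 1 (y ∷ w))

value-inRange : ∀ {n} (β : SignedPerm n) (i : Fin n) → InRange n (value β i)
value-inRange β i with negative β i
... | true  = toℕ<n (perm β ⟨$⟩ʳ i)
... | false = toℕ<n (perm β ⟨$⟩ʳ i)

proposition3p1 : (n : ℕ) → n ≥ 1 → (β : SignedPerm n) →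
    (dR β ≡ desB β) × (majR β ≡ maj β + neg β)
proposition3p1 (suc m) _ β =
  reiner-count (value β Fin.zero) rest entries-inRange ,
  reiner-major (value β Fin.zero) rest entries-inRange
  where
  open Telescoping (suc m)
  rest : List ℤ
  rest = map (value β) (tabulate Fin.suc)

  entries-inRange : All (InRange (suc m)) (window β)
  entries-inRange = map⁺ (universal (value-inRange β) _)
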